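{- Let $r\ge2$ be an integer. For a strictly increasing sequence $v_1<v_2<\cdots$ of positive integers, let $i_n$ be the number of base-$r$ digits of $v_n$ and, for a digit $j\in\{0,\dots,r-1\}$, let $l_{i_n j}$ be the number of occurrences of $j$ in the base-$r$ expansion of $v_n$; call the sequence irregular if for some $j\in\{1,2,\dots,r-1\}$ the limit $\lim_{n\to\infty} l_{i_n j}/i_n$ does not exist. Then irregular sequences exist. Moreover, if $r>2$, there exist irregular sequences $\{v_n\}$ with $\sum_n \frac1{v_n}<\infty$, and there exist irregular sequences $\{v_n\}$ with $\sum_n\frac1{v_n}=\infty$. -}

module Defs where

open import Data.Nat using (ℕ; zero; suc; _≤_; _<_; NonZero; _≡ᵇ_)
open import Data.Nat.DivMod using (_/_; _%_)
open import Data.List using (List; []; _∷_; length)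
open import Data.Bool using (if_then_else_)
open import Data.Integer using (+_)
open import Data.Rational as ℚ using (ℚ; 0ℚ; ∣_∣; _-_; _+_)
open import Data.Product using (Σ; ∃; _×_)
open import Relation.Nullary using (¬_)

-- base-r digits of n, least significant first; n = 0 has no digits.
-- The fuel argument (initially n) suffices since n / r < n for n > 0, r ≥ 2.
digitsFuel : (r : ℕ) → {{NonZero r}} → ℕ → ℕ → List ℕ
digitsFuel r zero    n = []
digitsFuel r (suc f) zero = []
digitsFuel r (suc f) n@(suc _) = (n % r) ∷ digitsFuel r f (n / r)

digits : (r : ℕ) → {{NonZero r}} → ℕ → List ℕ
digits r n = digitsFuel r n n

count : ℕ → List ℕ → ℕ
count j [] = 0
count j (d ∷ ds) = if j ≡ᵇ d then suc (count j ds) else count j ds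

numDigits : (r : ℕ) → {{NonZero r}} → ℕ → ℕ
numDigits r v = length (digits r v)

occ : (r : ℕ) → {{NonZero r}} → ℕ → ℕ → ℕ
occ r j v = count j (digits r v)

-- l_{i j}/i as a rational (0 by convention when v has no digits, i.e. v = 0)
freq : (r : ℕ) → {{NonZero r}} → ℕ → ℕ → ℚ
freq r j v with numDigits r v
... | zero  = 0ℚ
... | suc m = (+ occ r j v) ℚ./ suc m

-- A rational sequence has a (real) limit iff it is Cauchy (ℝ = Cauchy completion of ℚ)
Convergent : (ℕ → ℚ) → Set
Convergent a = ∀ (ε : ℚ) → 0ℚ ℚ.< ε →
  ∃ λ N → ∀ m n → N ≤ m → N ≤ n → ∣ a m - a n ∣ ℚ.< ε

StrictlyIncreasing : (ℕ → ℕ) → Set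
StrictlyIncreasing v = ∀ n → v n < v (suc n)

-- sequence of positive integers v_1 < v_2 < ... (indexed from 0 here)
PosIncreasing : (ℕ → ℕ) → Set
PosIncreasing v = (1 ≤ v 0) × StrictlyIncreasing v

Irregular : (r : ℕ) → {{NonZero r}} → (ℕ → ℕ) → Set
Irregular r v = PosIncreasing v ×
  Σ ℕ λ j → (1 ≤ j) × (j < r) × ¬ Convergent (λ n → freq r j (v n))

-- 1/n as a rational (0 for n = 0, never used for positive sequences)
recip : ℕ → ℚ
recip zero = 0ℚ
recip (suc m) = (+ 1) ℚ./ suc m

partialSum : (ℕ → ℕ) → ℕ → ℚ
partialSum v zero = 0ℚ
partialSum v (suc N) = partialSum v N + recip (v N)

-- Σ 1/v_n < ∞  (positive terms: partial sums bounded)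
ReciprocalSumFinite : (ℕ → ℕ) → Set
ReciprocalSumFinite v = ∃ λ (B : ℚ) → ∀ N → partialSum v N ℚ.≤ B

ReciprocalSumInfinite : (ℕ → ℕ) → Set
ReciprocalSumInfinite v = ∀ (B : ℚ) → ∃ λ N → B ℚ.< partialSum v N

{-# OPTIONS --safe #-}
module Submission where

-- In base r the digit 1 has frequency 1 in a repunit 11…1 and frequency 1/(k+1) ≤ ½ in
-- r ^ k = 10…0, so an increasing sequence containing infinitely many numbers of each kind
-- has no limiting frequency of 1. The positive integers are such a sequence, and their
-- reciprocal sum diverges since the harmonic series gains ½ on every block (2^j, 2^(j+1)].
-- Alternating repunits and powers with (n+1)(n+2) + 1 digits gives one whose n-th term exceeds
-- (n+1)(n+2); as 1/((n+1)(n+2)) = 1/(n+1) − 1/(n+2), its reciprocal sum is at most 1.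
-- Neither construction needs r > 2.

open import Defs
open import Data.Nat using (ℕ; zero; suc; pred; _+_; _*_; _^_; _≤_; _<_; z≤n; s≤s; s≤s⁻¹; z<s; NonZero; >-nonZero⁻¹)
open import Data.Nat.Properties
open import Data.Nat.DivMod using (_/_; _%_; [m+kn]%n≡m%n; m<n⇒m%n≡m; m*n/n≡m; m/n<m; m<n⇒m/n≡0; +-distrib-/-∣ʳ)
open import Data.Nat.Divisibility using (n∣m*n)
open import Data.Nat.Tactic.RingSolver using (solve-∀; solve)
open import Data.Integer as ℤ using (+_; -[1+_])
import Data.Integer.Properties as ℤ
open import Data.Rational as ℚ using (ℚ; mkℚ; 0ℚ; 1ℚ; ½; toℚᵘ)
import Data.Rational.Properties as ℚ
open import Data.Rational.Unnormalised as ℚᵘ using (mkℚᵘ; *≡*; *≤*; *<*)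
import Data.Rational.Unnormalised.Properties as ℚᵘ
open import Data.List using ([]; _∷_; _++_; length; replicate)
open import Data.List.Properties using (length-++; length-replicate)
open import Data.Product using (∃; _×_; _,_; proj₁; proj₂)
open import Function using (_∘_)
open import Relation.Nullary using (¬_)
open import Relation.Binary.PropositionalEquality

toℚᵘ-/ : ∀ a b → toℚᵘ (+ a ℚ./ suc b) ℚᵘ.≃ mkℚᵘ (+ a) b
toℚᵘ-/ a b = ℚ.toℚᵘ-fromℚᵘ (mkℚᵘ (+ a) b)

/≤/-cross : ∀ a b c d → a * suc d ≤ c * suc b → + a ℚ./ suc b ℚ.≤ + c ℚ./ suc d
/≤/-cross a b c d ad≤cb = ℚ.toℚᵘ-cancel-≤
  (ℚᵘ.≤-respˡ-≃ (ℚᵘ.≃-sym (toℚᵘ-/ a b)) (ℚᵘ.≤-respʳ-≃ (ℚᵘ.≃-sym (toℚᵘ-/ c d))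
    (*≤* (subst₂ ℤ._≤_ (ℤ.pos-* a (suc d)) (ℤ.pos-* c (suc b)) (ℤ.+≤+ ad≤cb)))))

/-+-/ : ∀ a b c d →
  + a ℚ./ suc b ℚ.+ + c ℚ./ suc d ≡ + (a * suc d + c * suc b) ℚ./ (suc b * suc d)
/-+-/ a b c d = ℚ.toℚᵘ-injective (begin
  toℚᵘ (+ a ℚ./ suc b ℚ.+ + c ℚ./ suc d)             ≈⟨ ℚ.toℚᵘ-homo-+ (+ a ℚ./ suc b) _ ⟩
  toℚᵘ (+ a ℚ./ suc b) ℚᵘ.+ toℚᵘ (+ c ℚ./ suc d)      ≈⟨ ℚᵘ.+-cong (toℚᵘ-/ a b) (toℚᵘ-/ c d) ⟩
  mkℚᵘ (+ a) b ℚᵘ.+ mkℚᵘ (+ c) d                       ≡⟨ cong (ℚᵘ._/ (suc b * suc d)) numerator ⟩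
  + (a * suc d + c * suc b) ℚᵘ./ (suc b * suc d)      ≈⟨ ℚᵘ.≃-sym (toℚᵘ-/ _ _) ⟩
  toℚᵘ (+ (a * suc d + c * suc b) ℚ./ (suc b * suc d)) ∎)
  where
  open ℚᵘ.≃-Reasoning
  numerator : + a ℤ.* + suc d ℤ.+ + c ℤ.* + suc b ≡ + (a * suc d + c * suc b)
  numerator = trans (cong₂ ℤ._+_ (sym (ℤ.pos-* a (suc d))) (sym (ℤ.pos-* c (suc b))))
                    (sym (ℤ.pos-+ (a * suc d) (c * suc b)))

/+/≤/-cross : ∀ a b c d e f → (a * suc d + c * suc b) * suc f ≤ e * (suc b * suc d) →
  + a ℚ./ suc b ℚ.+ + c ℚ./ suc d ℚ.≤ + e ℚ./ suc f
/+/≤/-cross a b c d e f cross =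
  subst (λ q → q ℚ.≤ + e ℚ./ suc f) (sym (/-+-/ a b c d))
    (/≤/-cross (a * suc d + c * suc b) (d + b * suc d) e f cross)

/≤/+/-cross : ∀ a b c d e f → e * (suc b * suc d) ≤ (a * suc d + c * suc b) * suc f →
  + e ℚ./ suc f ℚ.≤ + a ℚ./ suc b ℚ.+ + c ℚ./ suc d
/≤/+/-cross a b c d e f cross =
  subst (λ q → + e ℚ./ suc f ℚ.≤ q) (sym (/-+-/ a b c d))
    (/≤/-cross e f (a * suc d + c * suc b) (d + b * suc d) cross)

n/n≡1 : ∀ n → + suc n ℚ./ suc n ≡ 1ℚ
n/n≡1 n = ℚ.toℚᵘ-injective (ℚᵘ.≃-trans (toℚᵘ-/ (suc n) n) (*≡* (ℤ.*-comm (+ suc n) (+ 1))))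

InfinitelyOften : (ℕ → Set) → Set
InfinitelyOften P = ∀ N → ∃ λ n → N ≤ n × P n

InfinitelyOften-map : ∀ {P Q : ℕ → Set} → (∀ {n} → P n → Q n) → InfinitelyOften P → InfinitelyOften Q
InfinitelyOften-map f often N = let n , N≤n , Pn = often N in n , N≤n , f Pn

0<½ : 0ℚ ℚ.< ½
0<½ = ℚ.*<* (ℤ.+<+ z<s)

¬Convergent-oscillating : ∀ {a : ℕ → ℚ} →
  InfinitelyOften (λ n → 1ℚ ℚ.≤ a n) → InfinitelyOften (λ n → a n ℚ.≤ ½) → ¬ Convergent a
¬Convergent-oscillating {a} high low convergent with convergent ½ 0<½
... | N , cauchy with high N | low N
... | m , N≤m , 1≤am | n , N≤n , an≤½ =
  ℚ.<-irrefl refl (ℚ.≤-<-trans ½≤∣am-an∣ (cauchy m n N≤m N≤n))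
  where
  ½≤am-an : ½ ℚ.≤ a m ℚ.- a n
  ½≤am-an = ℚ.+-mono-≤ 1≤am (ℚ.neg-antimono-≤ an≤½)
  ½≤∣am-an∣ : ½ ℚ.≤ ℚ.∣ a m ℚ.- a n ∣
  ½≤∣am-an∣ = subst (½ ℚ.≤_) (sym (ℚ.0≤p⇒∣p∣≡p (ℚ.≤-trans (ℚ.<⇒≤ 0<½) ½≤am-an))) ½≤am-an

recip-+-telescope : ∀ x n → suc n * suc (suc n) ≤ x →
  recip x ℚ.+ + 1 ℚ./ suc (suc n) ℚ.≤ + 1 ℚ./ suc n
recip-+-telescope (suc m) n n₁n₂≤x = /+/≤/-cross 1 m 1 (suc n) 1 n (begin
  (1 * suc (suc n) + 1 * suc m) * suc n  ≡⟨ solve (m ∷ n ∷ []) ⟩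
  suc n * suc (suc n) + suc m * suc n    ≤⟨ +-monoˡ-≤ (suc m * suc n) n₁n₂≤x ⟩
  suc m + suc m * suc n                  ≡⟨ solve (m ∷ n ∷ []) ⟩
  1 * (suc m * suc (suc n))              ∎)
  where open ≤-Reasoning

partialSum-+-tail≤1 : ∀ {v} → (∀ n → suc n * suc (suc n) ≤ v n) →
  ∀ N → partialSum v N ℚ.+ + 1 ℚ./ suc N ℚ.≤ 1ℚ
partialSum-+-tail≤1 v-large zero = ℚ.≤-refl
partialSum-+-tail≤1 {v} v-large (suc N) = begin
  partialSum v N ℚ.+ recip (v N) ℚ.+ + 1 ℚ./ suc (suc N)
    ≡⟨ ℚ.+-assoc (partialSum v N) (recip (v N)) _ ⟩
  partialSum v N ℚ.+ (recip (v N) ℚ.+ + 1 ℚ./ suc (suc N))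
    ≤⟨ ℚ.+-monoʳ-≤ (partialSum v N) (recip-+-telescope (v N) N (v-large N)) ⟩
  partialSum v N ℚ.+ + 1 ℚ./ suc N
    ≤⟨ partialSum-+-tail≤1 v-large N ⟩
  1ℚ ∎
  where open ℚ.≤-Reasoning

quadratic⇒ReciprocalSumFinite : ∀ {v} → (∀ n → suc n * suc (suc n) ≤ v n) → ReciprocalSumFinite v
quadratic⇒ReciprocalSumFinite {v} v-large = 1ℚ , λ N → begin
  partialSum v N                       ≡⟨ ℚ.+-identityʳ (partialSum v N) ⟨
  partialSum v N ℚ.+ 0ℚ                ≤⟨ ℚ.+-monoʳ-≤ (partialSum v N) (/≤/-cross 0 0 1 N z≤n) ⟩
  partialSum v N ℚ.+ + 1 ℚ./ suc N     ≤⟨ partialSum-+-tail≤1 v-large N ⟩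
  1ℚ                                   ∎
  where open ℚ.≤-Reasoning

harmonic : ℕ → ℚ
harmonic = partialSum suc

harmonic-block : ∀ a m t → a + m ≤ suc t → harmonic a ℚ.+ + m ℚ./ suc t ℚ.≤ harmonic (a + m)
harmonic-block a zero t _ = begin
  harmonic a ℚ.+ + 0 ℚ./ suc t  ≡⟨ cong (harmonic a ℚ.+_) (ℚ.0/n≡0 (suc t)) ⟩
  harmonic a ℚ.+ 0ℚ             ≡⟨ ℚ.+-identityʳ (harmonic a) ⟩
  harmonic a                    ≡⟨ cong harmonic (+-identityʳ a) ⟨
  harmonic (a + 0)              ∎
  where open ℚ.≤-Reasoning
harmonic-block a (suc m) t a+m₁≤t₁ = begin
  harmonic a ℚ.+ + suc m ℚ./ suc t
    ≤⟨ ℚ.+-monoʳ-≤ (harmonic a) (/≤/+/-cross m t 1 t (suc m) t (≤-reflexive (solve (m ∷ t ∷ [])))) ⟩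
  harmonic a ℚ.+ (+ m ℚ./ suc t ℚ.+ + 1 ℚ./ suc t)
    ≡⟨ ℚ.+-assoc (harmonic a) _ _ ⟨
  harmonic a ℚ.+ + m ℚ./ suc t ℚ.+ + 1 ℚ./ suc t
    ≤⟨ ℚ.+-mono-≤ (harmonic-block a m t (<⇒≤ a+m<t₁)) (/≤/-cross 1 t 1 (a + m) (*-monoʳ-≤ 1 a+m<t₁)) ⟩
  harmonic (a + m) ℚ.+ + 1 ℚ./ suc (a + m)
    ≡⟨ cong harmonic (+-suc a m) ⟨
  harmonic (a + suc m) ∎
  where
  open ℚ.≤-Reasoning
  a+m<t₁ : a + m < suc t
  a+m<t₁ = subst (_≤ suc t) (+-suc a m) a+m₁≤t₁

mersenne : ℕ → ℕ
mersenne zero = 0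
mersenne (suc j) = mersenne j + suc (mersenne j)

half≤harmonic-mersenne : ∀ j → + j ℚ./ 2 ℚ.≤ harmonic (suc (mersenne j))
half≤harmonic-mersenne zero = /≤/-cross 0 1 1 0 z≤n
half≤harmonic-mersenne (suc j) = begin
  + suc j ℚ./ 2
    ≤⟨ /≤/+/-cross j 1 1 1 (suc j) 1 (≤-reflexive (solve (j ∷ []))) ⟩
  + j ℚ./ 2 ℚ.+ ½
    ≤⟨ ℚ.+-mono-≤ (half≤harmonic-mersenne j) (/≤/-cross 1 1 (suc M) (M + suc M) (≤-reflexive (halves M))) ⟩
  harmonic (suc M) ℚ.+ + suc M ℚ./ suc (M + suc M)
    ≤⟨ harmonic-block (suc M) (suc M) (M + suc M) ≤-refl ⟩
  harmonic (suc M + suc M) ∎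
  where
  open ℚ.≤-Reasoning
  M = mersenne j
  halves : ∀ x → 1 * suc (x + suc x) ≡ suc x * 2
  halves = solve-∀

archimedean : ∀ p → ∃ λ k → p ℚ.< + k ℚ./ 1
archimedean (mkℚ (+ n) d _) = suc n ,
  ℚ.toℚᵘ-cancel-< (ℚᵘ.<-respʳ-≃ (ℚᵘ.≃-sym (toℚᵘ-/ (suc n) 0))
    (*<* (subst (ℤ._< + (suc n * suc d)) (ℤ.pos-* n 1) (ℤ.+<+ (s≤s n*1≤d+n*d₁)))))
  where
  n*1≤d+n*d₁ : n * 1 ≤ d + n * suc d
  n*1≤d+n*d₁ = ≤-trans (*-monoʳ-≤ n (s≤s z≤n)) (m≤n+m (n * suc d) d)
archimedean (mkℚ -[1+ n ] d _) = 0 ,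
  ℚ.toℚᵘ-cancel-< (ℚᵘ.<-respʳ-≃ (ℚᵘ.≃-sym (toℚᵘ-/ 0 0)) (*<* ℤ.-<+))

harmonic-unbounded : ReciprocalSumInfinite suc
harmonic-unbounded B with archimedean B
... | k , B<k = suc (mersenne (k + k)) , (begin-strict
  B                                     <⟨ B<k ⟩
  + k ℚ./ 1                             ≤⟨ /≤/-cross k 0 (k + k) 1 (≤-reflexive (solve (k ∷ []))) ⟩
  + (k + k) ℚ./ 2                       ≤⟨ half≤harmonic-mersenne (k + k) ⟩
  harmonic (suc (mersenne (k + k)))     ∎)
  where open ℚ.≤-Reasoning

alternate : ∀ {A : Set} → ℕ → A → A → A
alternate zero          x y = x
alternate (suc zero)    x y = y
alternate (suc (suc n)) x y = alternate n x y

alternate-elim : ∀ {A : Set} (P : A → Set) n {x y} → P x → P y → P (alternate n x y)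
alternate-elim P zero          px py = px
alternate-elim P (suc zero)    px py = py
alternate-elim P (suc (suc n)) px py = alternate-elim P n px py

alternate-even : ∀ {A : Set} n {x y : A} → alternate (n + n) x y ≡ x
alternate-even zero    = refl
alternate-even (suc n) rewrite +-suc n n = alternate-even n

alternate-odd : ∀ {A : Set} n {x y : A} → alternate (suc (n + n)) x y ≡ y
alternate-odd zero    = refl
alternate-odd (suc n) rewrite +-suc n n = alternate-odd n

exponent : ℕ → ℕ
exponent n = suc n * suc (suc n)

exponent-increasing : ∀ n → exponent n < exponent (suc n)
exponent-increasing n = *-mono-< (n<1+n (suc n)) (n<1+n (suc (suc n)))

module Digits (r : ℕ) {{_ : NonZero r}} (1<r : 1 < r) where

  digitsFuel-enough : ∀ f g n → n ≤ f → n ≤ g → digitsFuel r f n ≡ digitsFuel r g n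
  digitsFuel-enough zero    zero    zero    _ _ = refl
  digitsFuel-enough zero    (suc g) zero    _ _ = refl
  digitsFuel-enough (suc f) zero    zero    _ _ = refl
  digitsFuel-enough (suc f) (suc g) zero    _ _ = refl
  digitsFuel-enough zero    _       (suc n) () _
  digitsFuel-enough (suc f) zero    (suc n) _ ()
  digitsFuel-enough (suc f) (suc g) (suc n) (s≤s n≤f) (s≤s n≤g) =
    cong (suc n % r ∷_) (digitsFuel-enough f g (suc n / r) (≤-trans q≤n n≤f) (≤-trans q≤n n≤g))
    where
    q≤n : suc n / r ≤ n
    q≤n = s≤s⁻¹ (m/n<m (suc n) r 1<r)

  digits-∷ : ∀ {d m k} → d < r → d + r * m ≡ suc k → digits r (suc k) ≡ d ∷ digits r m
  digits-∷ {d} {m} {k} d<r d+rm≡n = cong₂ _∷_ remainder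
    (trans (cong (digitsFuel r k) quotient) (digitsFuel-enough k m m m≤k ≤-refl))
    where
    n≡d+mr : suc k ≡ d + m * r
    n≡d+mr = trans (sym d+rm≡n) (cong (λ x → d + x) (*-comm r m))
    remainder : suc k % r ≡ d
    remainder = trans (cong (_% r) n≡d+mr) (trans ([m+kn]%n≡m%n d m r) (m<n⇒m%n≡m d<r))
    quotient : suc k / r ≡ m
    quotient = trans (cong (_/ r) n≡d+mr)
      (trans (+-distrib-/-∣ʳ d (n∣m*n m)) (cong₂ _+_ (m<n⇒m/n≡0 d<r) (m*n/n≡m m r)))
    m≤k : m ≤ k
    m≤k = s≤s⁻¹ (subst (_< suc k) quotient (m/n<m (suc k) r 1<r))

  digits-∷⁺ : ∀ {d m} → d < r → 0 < d + r * m → digits r (d + r * m) ≡ d ∷ digits r m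
  digits-∷⁺ {d} {m} d<r n>0 with d + r * m in d+rm≡n
  digits-∷⁺ d<r () | zero
  digits-∷⁺ d<r n>0 | suc k = digits-∷ d<r d+rm≡n

  repunit : ℕ → ℕ
  repunit zero    = 0
  repunit (suc k) = 1 + r * repunit k

  digits-repunit : ∀ k → digits r (repunit k) ≡ replicate k 1
  digits-repunit zero    = refl
  digits-repunit (suc k) = trans (digits-∷ 1<r refl) (cong (1 ∷_) (digits-repunit k))

  digits-^ : ∀ k → digits r (r ^ k) ≡ replicate k 0 ++ 1 ∷ []
  digits-^ zero    = digits-∷ 1<r (cong suc (*-zeroʳ r))
  digits-^ (suc k) = trans (digits-∷⁺ (>-nonZero⁻¹ r) (m^n>0 r (suc k))) (cong (0 ∷_) (digits-^ k))

  count-1-replicate-1 : ∀ k → count 1 (replicate k 1) ≡ k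
  count-1-replicate-1 zero    = refl
  count-1-replicate-1 (suc k) = cong suc (count-1-replicate-1 k)

  count-1-replicate-0 : ∀ k ds → count 1 (replicate k 0 ++ ds) ≡ count 1 ds
  count-1-replicate-0 zero    ds = refl
  count-1-replicate-0 (suc k) ds = count-1-replicate-0 k ds

  numDigits-repunit : ∀ k → numDigits r (repunit k) ≡ k
  numDigits-repunit k = trans (cong length (digits-repunit k)) (length-replicate k)

  occ-1-repunit : ∀ k → occ r 1 (repunit k) ≡ k
  occ-1-repunit k = trans (cong (count 1) (digits-repunit k)) (count-1-replicate-1 k)

  numDigits-^ : ∀ k → numDigits r (r ^ k) ≡ suc k
  numDigits-^ k = begin
    length (digits r (r ^ k))           ≡⟨ cong length (digits-^ k) ⟩
    length (replicate k 0 ++ 1 ∷ [])    ≡⟨ length-++ (replicate k 0) ⟩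
    length (replicate k 0) + 1          ≡⟨ cong (_+ 1) (length-replicate k) ⟩
    k + 1                               ≡⟨ +-comm k 1 ⟩
    suc k                               ∎
    where open ≡-Reasoning

  occ-1-^ : ∀ k → occ r 1 (r ^ k) ≡ 1
  occ-1-^ k = trans (cong (count 1) (digits-^ k)) (count-1-replicate-0 k (1 ∷ []))

  freq-numDigits : ∀ j v {m} → numDigits r v ≡ suc m → freq r j v ≡ + occ r j v ℚ./ suc m
  freq-numDigits j v eq with numDigits r v
  freq-numDigits j v refl | _ = refl

  freq-repunit : ∀ k → freq r 1 (repunit (suc k)) ≡ 1ℚ
  freq-repunit k = begin
    freq r 1 (repunit (suc k))                ≡⟨ freq-numDigits 1 (repunit (suc k)) (numDigits-repunit (suc k)) ⟩
    + occ r 1 (repunit (suc k)) ℚ./ suc k     ≡⟨ cong (λ c → + c ℚ./ suc k) (occ-1-repunit (suc k)) ⟩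
    + suc k ℚ./ suc k                         ≡⟨ n/n≡1 k ⟩
    1ℚ                                        ∎
    where open ≡-Reasoning

  freq-^≤½ : ∀ k → freq r 1 (r ^ suc k) ℚ.≤ ½
  freq-^≤½ k = begin
    freq r 1 (r ^ suc k)                      ≡⟨ freq-numDigits 1 (r ^ suc k) (numDigits-^ (suc k)) ⟩
    + occ r 1 (r ^ suc k) ℚ./ suc (suc k)     ≡⟨ cong (λ c → + c ℚ./ suc (suc k)) (occ-1-^ (suc k)) ⟩
    + 1 ℚ./ suc (suc k)                       ≤⟨ /≤/-cross 1 (suc k) 1 1 (s≤s (s≤s z≤n)) ⟩
    ½                                         ∎
    where open ℚ.≤-Reasoning

  n≤repunit : ∀ k → k ≤ repunit k
  n≤repunit zero    = z≤n
  n≤repunit (suc k) = s≤s (≤-trans (n≤repunit k) (m≤n*m (repunit k) r))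

  repunit<^ : ∀ k → repunit k < r ^ k
  repunit<^ zero    = z<s
  repunit<^ (suc k) = begin-strict
    1 + r * repunit k   <⟨ +-monoˡ-< (r * repunit k) 1<r ⟩
    r + r * repunit k   ≡⟨ *-suc r (repunit k) ⟨
    r * suc (repunit k) ≤⟨ *-monoʳ-≤ r (repunit<^ k) ⟩
    r * r ^ k           ∎
    where open ≤-Reasoning

  ^≤repunit : ∀ k → r ^ k ≤ repunit (suc k)
  ^≤repunit zero    = s≤s z≤n
  ^≤repunit (suc k) = m≤n⇒m≤1+n (*-monoʳ-≤ r (^≤repunit k))

  n<^ : ∀ k → k < r ^ k
  n<^ k = ≤-<-trans (n≤repunit k) (repunit<^ k)

  Repunit : ℕ → Set
  Repunit x = ∃ λ k → x ≡ repunit (suc k)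

  Power : ℕ → Set
  Power x = ∃ λ k → x ≡ r ^ suc k

  repunits∧powers⇒Irregular : ∀ {v} → PosIncreasing v →
    InfinitelyOften (Repunit ∘ v) → InfinitelyOften (Power ∘ v) → Irregular r v
  repunits∧powers⇒Irregular {v} v-inc repunits powers =
    v-inc , 1 , ≤-refl , 1<r ,
    ¬Convergent-oscillating (InfinitelyOften-map frequent repunits) (InfinitelyOften-map rare powers)
    where
    frequent : ∀ {n} → Repunit (v n) → 1ℚ ℚ.≤ freq r 1 (v n)
    frequent (k , vn≡R) = ℚ.≤-reflexive (sym (trans (cong (freq r 1) vn≡R) (freq-repunit k)))
    rare : ∀ {n} → Power (v n) → freq r 1 (v n) ℚ.≤ ½
    rare (k , vn≡r^) = subst (λ x → freq r 1 x ℚ.≤ ½) (sym vn≡r^) (freq-^≤½ k)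

  positives-irregular : Irregular r suc
  positives-irregular = repunits∧powers⇒Irregular (≤-refl , λ _ → ≤-refl) repunits powers
    where
    repunits : InfinitelyOften (Repunit ∘ suc)
    repunits N = r * repunit N , ≤-trans (n≤repunit N) (m≤n*m (repunit N) r) , N , refl
    powers : InfinitelyOften (Power ∘ suc)
    powers N = pred (r ^ suc N) , ≤-trans (n≤1+n N) (<⇒≤pred (n<^ (suc N))) ,
               N , suc-pred (r ^ suc N) {{m^n≢0 r (suc N)}}

  sparse : ℕ → ℕ
  sparse n = alternate n (repunit (suc (exponent n))) (r ^ exponent n)

  sparse-bounds : ∀ n → r ^ exponent n ≤ sparse n × sparse n < r ^ suc (exponent n)
  sparse-bounds n = alternate-elim (λ x → r ^ e ≤ x × x < r ^ suc e) n
    (^≤repunit e , repunit<^ (suc e)) (≤-refl , ^-monoʳ-< r 1<r (n<1+n e))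
    where e = exponent n

  sparse-increasing : StrictlyIncreasing sparse
  sparse-increasing n = begin-strict
    sparse n                       <⟨ proj₂ (sparse-bounds n) ⟩
    r ^ suc (exponent n)           ≤⟨ ^-monoʳ-≤ r (exponent-increasing n) ⟩
    r ^ exponent (suc n)           ≤⟨ proj₁ (sparse-bounds (suc n)) ⟩
    sparse (suc n)                 ∎
    where open ≤-Reasoning

  sparse-quadratic : ∀ n → suc n * suc (suc n) ≤ sparse n
  sparse-quadratic n = ≤-trans (<⇒≤ (n<^ (exponent n))) (proj₁ (sparse-bounds n))

  sparse-irregular : Irregular r sparse
  sparse-irregular = repunits∧powers⇒Irregular (<⇒≤ (sparse-quadratic 0) , sparse-increasing) repunits powers
    where
    repunits : InfinitelyOften (Repunit ∘ sparse)
    repunits N = N + N , m≤m+n N N , exponent (N + N) , alternate-even N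
    powers : InfinitelyOften (Power ∘ sparse)
    powers N = suc (N + N) , m≤n⇒m≤1+n (m≤m+n N N) , pred (exponent (suc (N + N))) , alternate-odd N

theorem7 : (r : ℕ) → {{_ : NonZero r}} → 2 ≤ r →
    (∃ λ v → Irregular r v) ×
    (2 < r →
      (∃ λ v → Irregular r v × ReciprocalSumFinite v) ×
      (∃ λ v → Irregular r v × ReciprocalSumInfinite v))
theorem7 r r≥2 =
  (sparse , sparse-irregular) ,
  λ _ → (sparse , sparse-irregular , quadratic⇒ReciprocalSumFinite sparse-quadratic) ,
        (suc , positives-irregular , harmonic-unbounded)
  where open Digits r r≥2
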